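{- Let $k$ be a positive integer, let $A_1,\dots,A_k$ be pairwise disjoint finite sets and $A=A_1\cup\dots\cup A_k$. For every linear order $\prec$ on $A$ there exist sets $B_1,\dots,B_k$ with $B_i\subseteq A_i$ and $|B_i|\geq |A_i|/k$ for all $i$, such that for all $i\neq j$ there do not exist $x,z\in B_i$ and $y\in B_j$ with $x\prec y\prec z$. -}

module Defs where

open import Data.Nat using (ℕ)
open import Data.Fin using (Fin)
open import Data.Fin.Subset using (Subset; _∈_; Empty; _∩_)
open import Relation.Binary.PropositionalEquality using (_≢_)
open import Data.Product using (∃)

PairwiseDisjoint : ∀ {k n} → (Fin k → Subset n) → Set
PairwiseDisjoint {k} A = ∀ (i j : Fin k) → i ≢ j → Empty (A i ∩ A j)

Covers : ∀ {k n} → (Fin k → Subset n) → Set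
Covers {k} {n} A = ∀ (x : Fin n) → ∃ λ (i : Fin k) → x ∈ A i

{-# OPTIONS --safe #-}

-- Scan the order from the left and stop at the first point where some class
-- still in play has collected a k-th of its elements since the last cut; give that stretch of
-- the class to it and continue to the right with the other classes. Passing one element moves
-- the count of only one class, so at a cut every other class has collected at most a k-th of
-- its elements; hence after r cuts each remaining class keeps at least (k − r)/k of its elements
-- to the right, enough to reach its own quota later. The chosen sets occupy consecutive
-- disjoint stretches of the order, so no two of them interleave.

module Submission where

open import Data.Empty using (⊥-elim)
open import Data.Fin using (Fin; _≟_)
open import Data.Fin.Properties using (any?)
open import Data.Fin.Subset
  using (Subset; _∈_; _∉_; _⊆_; ∣_∣; _∩_; _─_; _-_; ⊤; ⁅_⁆; Nonempty; Empty; inside; outside)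
open import Data.Fin.Subset.Properties
  using (_∈?_; nonempty?; ∈⊤; ∣⊤∣≡n; ∣⊥∣≡0; Empty-unique; x∈⁅x⁆; x∈p∩q⁺; x∈p∩q⁻; p─q⊆p;
         x∈p∧x≢y⇒x∈p-y; p⊆q⇒∣p∣≤∣q∣; p⊂q⇒∣p∣<∣q∣; ∣p∩q∣≤∣q∣; x∈p⇒∣p-x∣<∣p∣)
open import Data.Nat using (ℕ; zero; suc; _+_; _*_; _≤_; _<_; _≮_; _≤?_; _<?_; z≤n; s≤s⁻¹)
open import Data.Nat.Properties
  using (module ≤-Reasoning; ≤-refl; ≤-reflexive; ≤-trans; ≤-antisym; <-trans; <-≤-trans;
         <⇒≤; <⇒≢; >⇒≢; ≤∧≢⇒<; ≮⇒≥; ≰⇒>; n≮0; n<1+n; +-suc; +-identityʳ; +-monoˡ-≤;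
         +-cancelˡ-≤; +-cancelˡ-<; *-zeroʳ; *-distribˡ-+; *-monoʳ-≤; *-cancelˡ-<; m≤n*m)
open import Data.Product as Product using (∃; _×_; _,_; proj₁; proj₂)
open import Data.Vec using ([]; _∷_; tabulate; here; there)
open import Data.Vec.Properties using (lookup∘tabulate; []=⇒lookup; lookup⇒[]=)
open import Defs
open import Function using (_∘_)
open import Relation.Binary using (Rel; tri<; tri≈; tri>)
open import Relation.Binary.PropositionalEquality using (_≡_; _≢_; refl; sym; trans; cong; subst)
open import Relation.Binary.Structures using (IsStrictTotalOrder)
open import Relation.Nullary using (¬_; yes; no; does; contradiction)
open import Relation.Nullary.Decidable using (_×-dec_; dec-true)
open import Relation.Unary using (Pred; Decidable)

∣p∣≡∣p∩q∣+∣p─q∣ : ∀ {n} (p q : Subset n) → ∣ p ∣ ≡ ∣ p ∩ q ∣ + ∣ p ─ q ∣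
∣p∣≡∣p∩q∣+∣p─q∣ []            []            = refl
∣p∣≡∣p∩q∣+∣p─q∣ (outside ∷ p) (inside  ∷ q) = ∣p∣≡∣p∩q∣+∣p─q∣ p q
∣p∣≡∣p∩q∣+∣p─q∣ (outside ∷ p) (outside ∷ q) = ∣p∣≡∣p∩q∣+∣p─q∣ p q
∣p∣≡∣p∩q∣+∣p─q∣ (inside  ∷ p) (inside  ∷ q) = cong suc (∣p∣≡∣p∩q∣+∣p─q∣ p q)
∣p∣≡∣p∩q∣+∣p─q∣ (inside  ∷ p) (outside ∷ q) =
  trans (cong suc (∣p∣≡∣p∩q∣+∣p─q∣ p q)) (sym (+-suc (∣ p ∩ q ∣) (∣ p ─ q ∣)))

0<∣p∣⇒p≢∅ : ∀ {n} (p : Subset n) → 0 < ∣ p ∣ → Nonempty p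
0<∣p∣⇒p≢∅ (inside  ∷ p) _     = _ , here
0<∣p∣⇒p≢∅ (outside ∷ p) 0<∣p∣ = Product.map Fin.suc there (0<∣p∣⇒p≢∅ p 0<∣p∣)

x∈p─q⇒x∉q : ∀ {n} {x : Fin n} (p q : Subset n) → x ∈ p ─ q → x ∉ q
x∈p─q⇒x∉q (_ ∷ p) (inside  ∷ q) () here
x∈p─q⇒x∉q (_ ∷ p) (outside ∷ q) here ()
x∈p─q⇒x∉q (_ ∷ p) (_ ∷ q) (there x∈p─q) (there x∈q) = x∈p─q⇒x∉q p q x∈p─q x∈q

x∈p-y⇒x≢y : ∀ {n} {x y : Fin n} (p : Subset n) → x ∈ p - y → x ≢ y
x∈p-y⇒x≢y {y = y} p x∈p-y refl = x∈p─q⇒x∉q p ⁅ y ⁆ x∈p-y (x∈⁅x⁆ y)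

∣p∣<∣q∣⇒q─p≢∅ : ∀ {n} (p q : Subset n) → ∣ p ∣ < ∣ q ∣ → Nonempty (q ─ p)
∣p∣<∣q∣⇒q─p≢∅ p q ∣p∣<∣q∣ = 0<∣p∣⇒p≢∅ (q ─ p) (+-cancelˡ-< (∣ p ∣) 0 (∣ q ─ p ∣) (begin-strict
  ∣ p ∣ + 0               ≡⟨ +-identityʳ (∣ p ∣) ⟩
  ∣ p ∣                   <⟨ ∣p∣<∣q∣ ⟩
  ∣ q ∣                   ≡⟨ ∣p∣≡∣p∩q∣+∣p─q∣ q p ⟩
  ∣ q ∩ p ∣ + ∣ q ─ p ∣   ≤⟨ +-monoˡ-≤ (∣ q ─ p ∣) (∣p∩q∣≤∣q∣ q p) ⟩
  ∣ p ∣ + ∣ q ─ p ∣       ∎))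
  where open ≤-Reasoning

∣p─q∣-keeps-share : ∀ {n} m d a (p q : Subset n) →
  suc m * a ≤ d * ∣ p ∣ → d * ∣ p ∩ q ∣ ≤ a → m * a ≤ d * ∣ p ─ q ∣
∣p─q∣-keeps-share m d a p q whole≤ inside≤ = +-cancelˡ-≤ a (m * a) (d * ∣ p ─ q ∣) (begin
  a + m * a                           ≤⟨ whole≤ ⟩
  d * ∣ p ∣                           ≡⟨ cong (d *_) (∣p∣≡∣p∩q∣+∣p─q∣ p q) ⟩
  d * (∣ p ∩ q ∣ + ∣ p ─ q ∣)         ≡⟨ *-distribˡ-+ d (∣ p ∩ q ∣) (∣ p ─ q ∣) ⟩
  d * ∣ p ∩ q ∣ + d * ∣ p ─ q ∣       ≤⟨ +-monoˡ-≤ (d * ∣ p ─ q ∣) inside≤ ⟩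
  a + d * ∣ p ─ q ∣                   ∎)
  where open ≤-Reasoning

PairwiseDisjoint-⊆ : ∀ {k n} {C D : Fin k → Subset n} →
  (∀ j → D j ⊆ C j) → PairwiseDisjoint C → PairwiseDisjoint D
PairwiseDisjoint-⊆ D⊆C disjoint i j i≢j (x , x∈Di∩Dj) with x∈p∩q⁻ _ _ x∈Di∩Dj
... | x∈Di , x∈Dj = disjoint i j i≢j (x , x∈p∩q⁺ (D⊆C i x∈Di , D⊆C j x∈Dj))

least-witness : ∀ {p} {P : Pred ℕ p} → Decidable P →
  ∀ {n} → P n → ∃ λ s → P s × (∀ {t} → t < s → ¬ P t)
least-witness P? {zero} P0 = 0 , P0 , λ ()
least-witness P? {suc n} Pn with P? 0
... | yes P0 = 0 , P0 , λ ()
... | no ¬P0 with least-witness (P? ∘ suc) Pn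
...   | s , Ps , below = suc s , Ps , λ { {zero} _ → ¬P0 ; {suc t} t<s → below (s≤s⁻¹ t<s) }

module _ {n p} {P : Pred (Fin n) p} (P? : Decidable P) where

  toSubset : Subset n
  toSubset = tabulate (does ∘ P?)

  ∈toSubset⁺ : ∀ {x} → P x → x ∈ toSubset
  ∈toSubset⁺ {x} Px =
    lookup⇒[]= x toSubset (trans (lookup∘tabulate (does ∘ P?) x) (dec-true (P? x) Px))

  ∈toSubset⁻ : ∀ {x} → x ∈ toSubset → P x
  ∈toSubset⁻ {x} x∈ with P? x | trans (sym (lookup∘tabulate (does ∘ P?) x)) ([]=⇒lookup x∈)
  ... | yes Px | _  = Px
  ... | no  _  | ()

module Ranks {n ℓ} {_≺_ : Rel (Fin n) ℓ} (≺-sto : IsStrictTotalOrder _≡_ _≺_) where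

  open IsStrictTotalOrder ≺-sto using (compare; irrefl) renaming (trans to ≺-trans; _<?_ to _≺?_)

  rank : Fin n → ℕ
  rank x = ∣ toSubset (_≺? x) ∣

  rank-mono : ∀ {x y} → x ≺ y → rank x < rank y
  rank-mono {x} {y} x≺y = p⊂q⇒∣p∣<∣q∣
    ( (λ z≺x → ∈toSubset⁺ (_≺? y) (≺-trans (∈toSubset⁻ (_≺? x) z≺x) x≺y))
    , x , ∈toSubset⁺ (_≺? y) x≺y , irrefl refl ∘ ∈toSubset⁻ (_≺? x))

  rank-injective : ∀ {x y} → rank x ≡ rank y → x ≡ y
  rank-injective {x} {y} rx≡ry with compare x y
  ... | tri< x≺y _ _ = contradiction rx≡ry (<⇒≢ (rank-mono x≺y))
  ... | tri≈ _ x≡y _ = x≡y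
  ... | tri> _ _ y≺x = contradiction rx≡ry (>⇒≢ (rank-mono y≺x))

  rank<n : ∀ x → rank x < n
  rank<n x = <-≤-trans
    (p⊂q⇒∣p∣<∣q∣ ((λ _ → ∈⊤) , x , ∈⊤ , irrefl refl ∘ ∈toSubset⁻ (_≺? x)))
    (≤-reflexive (∣⊤∣≡n n))

  prefix : ℕ → Subset n
  prefix s = toSubset (λ x → rank x <? s)

  ∈prefix⁺ : ∀ {s x} → rank x < s → x ∈ prefix s
  ∈prefix⁺ {s} = ∈toSubset⁺ (λ x → rank x <? s)

  ∈prefix⁻ : ∀ {s x} → x ∈ prefix s → rank x < s
  ∈prefix⁻ {s} = ∈toSubset⁻ (λ x → rank x <? s)

  prefix-downward : ∀ {s x y} → x ≺ y → y ∈ prefix s → x ∈ prefix s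
  prefix-downward {s} x≺y y∈ = ∈prefix⁺ {s} (<-trans (rank-mono x≺y) (∈prefix⁻ y∈))

  ∣∩prefix0∣≡0 : ∀ (C : Subset n) → ∣ C ∩ prefix 0 ∣ ≡ 0
  ∣∩prefix0∣≡0 C = trans (cong ∣_∣ (Empty-unique no-element)) (∣⊥∣≡0 n)
    where
    no-element : Empty (C ∩ prefix 0)
    no-element (x , x∈) = n≮0 (∈prefix⁻ (proj₂ (x∈p∩q⁻ C _ x∈)))

  ∩prefix-stable : ∀ {t} (C : Subset n) → (∀ {x} → x ∈ C → rank x ≢ t) →
    C ∩ prefix (suc t) ⊆ C ∩ prefix t
  ∩prefix-stable C no-rank-t x∈ with x∈p∩q⁻ C _ x∈
  ... | x∈C , x∈prefix = x∈p∩q⁺ (x∈C , ∈prefix⁺ (≤∧≢⇒< (s≤s⁻¹ (∈prefix⁻ x∈prefix)) (no-rank-t x∈C)))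

  ∩prefix-growth : ∀ {t} (C : Subset n) → ∣ C ∩ prefix t ∣ < ∣ C ∩ prefix (suc t) ∣ →
    ∃ λ x → x ∈ C × rank x ≡ t
  ∩prefix-growth {t} C grows with ∣p∣<∣q∣⇒q─p≢∅ (C ∩ prefix t) (C ∩ prefix (suc t)) grows
  ... | x , x∈new with x∈p∩q⁻ C _ (p─q⊆p _ _ x∈new)
  ...   | x∈C , x∈prefix = x , x∈C , ≤-antisym (s≤s⁻¹ (∈prefix⁻ x∈prefix)) (≮⇒≥ x∉prefix)
    where
    x∉prefix : rank x ≮ t
    x∉prefix = x∈p─q⇒x∉q _ _ x∈new ∘ x∈p∩q⁺ ∘ (x∈C ,_) ∘ ∈prefix⁺

module Greedy {n ℓ} {_≺_ : Rel (Fin n) ℓ} (≺-sto : IsStrictTotalOrder _≡_ _≺_)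
              {k} (d : ℕ) (a : Fin k → ℕ) where

  open Ranks ≺-sto

  Separated : Subset k → (Fin k → Subset n) → Set ℓ
  Separated S B = ∀ {i j} → i ∈ S → j ∈ S → i ≢ j →
    ∀ {x y z} → x ∈ B i → z ∈ B i → y ∈ B j → ¬ (x ≺ y × y ≺ z)

  record Selection (S : Subset k) (C : Fin k → Subset n) : Set ℓ where
    field
      B         : Fin k → Subset n
      B⊆C       : ∀ {j} → j ∈ S → B j ⊆ C j
      quota     : ∀ {j} → j ∈ S → a j ≤ d * ∣ B j ∣
      separated : Separated S B

  record Cut (S : Subset k) (C : Fin k → Subset n) : Set where
    field
      s                  : ℕ
      i                  : Fin k
      i∈S                : i ∈ S
      i-reaches-quota    : a i ≤ d * ∣ C i ∩ prefix s ∣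
      others-below-quota : ∀ {j} → j ∈ S → j ≢ i → d * ∣ C j ∩ prefix s ∣ ≤ a j

  module _ {S : Subset k} {C : Fin k → Subset n} (disjoint : PairwiseDisjoint C) where

    ReachesQuota : ℕ → Set
    ReachesQuota s = ∃ λ i → i ∈ S × a i ≤ d * ∣ C i ∩ prefix s ∣

    reachesQuota? : Decidable ReachesQuota
    reachesQuota? s = any? (λ i → (i ∈? S) ×-dec (a i ≤? d * ∣ C i ∩ prefix s ∣))

    -- From prefix t to prefix (1+t) only the element of rank t enters, and it lies in at
    -- most one C j. At the least s = 1+t reaching a quota, C i has just grown, so C j has not.
    below-quota-before : ∀ {s i} → (∀ {t} → t < s → ¬ ReachesQuota t) →
      i ∈ S → a i ≤ d * ∣ C i ∩ prefix s ∣ →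
      ∀ {j} → j ∈ S → j ≢ i → d * ∣ C j ∩ prefix s ∣ ≤ a j
    below-quota-before {zero} _ _ _ {j} _ _ =
      ≤-trans (≤-reflexive (trans (cong (d *_) (∣∩prefix0∣≡0 (C j))) (*-zeroʳ d))) z≤n
    below-quota-before {suc t} {i} not-before i∈S reaches {j} j∈S j≢i = <⇒≤ (begin-strict
      d * ∣ C j ∩ prefix (suc t) ∣ ≤⟨ *-monoʳ-≤ d (p⊆q⇒∣p∣≤∣q∣ (∩prefix-stable (C j) no-rank-t)) ⟩
      d * ∣ C j ∩ prefix t ∣       <⟨ below-at-t j∈S ⟩
      a j                           ∎)
      where
      open ≤-Reasoning
      below-at-t : ∀ {l} → l ∈ S → d * ∣ C l ∩ prefix t ∣ < a l
      below-at-t l∈S = ≰⇒> (λ reaches-at-t → not-before (n<1+n t) (_ , l∈S , reaches-at-t))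
      no-rank-t : ∀ {y} → y ∈ C j → rank y ≢ t
      no-rank-t with ∩prefix-growth (C i) (*-cancelˡ-< d _ _ (<-≤-trans (below-at-t i∈S) reaches))
      ... | x , x∈Ci , rank-x = λ y∈Cj rank-y → disjoint i j (j≢i ∘ sym)
        (x , x∈p∩q⁺ (x∈Ci , subst (_∈ C j) (rank-injective (trans rank-y (sym rank-x))) y∈Cj))

    reachesQuota-at-n : ∀ {i} → i ∈ S → a i ≤ d * ∣ C i ∣ → ReachesQuota n
    reachesQuota-at-n {i} i∈S quota = i , i∈S , ≤-trans quota (*-monoʳ-≤ d (p⊆q⇒∣p∣≤∣q∣ C⊆C∩prefix))
      where
      C⊆C∩prefix : C i ⊆ C i ∩ prefix n
      C⊆C∩prefix x∈ = x∈p∩q⁺ (x∈ , ∈prefix⁺ {n} (rank<n _))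

    cut : ∀ {i₀} → i₀ ∈ S → a i₀ ≤ d * ∣ C i₀ ∣ → Cut S C
    cut i₀∈S quota₀ with least-witness reachesQuota? {n} (reachesQuota-at-n i₀∈S quota₀)
    ... | s , (i , i∈S , reaches) , not-before = record
      { s                  = s
      ; i                  = i
      ; i∈S                = i∈S
      ; i-reaches-quota    = reaches
      ; others-below-quota = below-quota-before not-before i∈S reaches
      }

  empty-selection : ∀ {S C} → Empty S → Selection S C
  empty-selection {C = C} S-empty = record
    { B         = C
    ; B⊆C       = λ _ x∈ → x∈
    ; quota     = λ j∈S → ⊥-elim (S-empty (_ , j∈S))
    ; separated = λ j∈S → ⊥-elim (S-empty (_ , j∈S))
    }

  extend : ∀ {S C} (c : Cut S C) → let open Cut c in
    Selection (S - i) (λ j → C j ─ prefix s) → Selection S C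
  extend {S} {C} c rest = record { B = B ; B⊆C = B⊆C ; quota = quota ; separated = separated }
    where
    open Cut c
    module rest = Selection rest

    B : Fin k → Subset n
    B j with j ≟ i
    ... | yes _ = C i ∩ prefix s
    ... | no  _ = rest.B j

    B⊆C : ∀ {j} → j ∈ S → B j ⊆ C j
    B⊆C {j} j∈S with j ≟ i
    ... | yes refl = proj₁ ∘ x∈p∩q⁻ (C i) _
    ... | no  j≢i  = p─q⊆p (C j) _ ∘ rest.B⊆C (x∈p∧x≢y⇒x∈p-y j∈S j≢i)

    quota : ∀ {j} → j ∈ S → a j ≤ d * ∣ B j ∣
    quota {j} j∈S with j ≟ i
    ... | yes refl = i-reaches-quota
    ... | no  j≢i  = rest.quota (x∈p∧x≢y⇒x∈p-y j∈S j≢i)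

    in-prefix : ∀ {x} → x ∈ C i ∩ prefix s → x ∈ prefix s
    in-prefix = proj₂ ∘ x∈p∩q⁻ (C i) _

    beyond-prefix : ∀ {j x} → j ∈ S → j ≢ i → x ∈ rest.B j → x ∉ prefix s
    beyond-prefix {j} j∈S j≢i = x∈p─q⇒x∉q (C j) _ ∘ rest.B⊆C (x∈p∧x≢y⇒x∈p-y j∈S j≢i)

    separated : Separated S B
    separated {j₁} {j₂} j₁∈S j₂∈S j₁≢j₂ x∈ z∈ y∈ (x≺y , y≺z) with j₁ ≟ i | j₂ ≟ i
    ... | yes refl | yes refl = j₁≢j₂ refl
    ... | yes refl | no  j₂≢i = beyond-prefix j₂∈S j₂≢i y∈ (prefix-downward {s} y≺z (in-prefix z∈))
    ... | no  j₁≢i | yes refl = beyond-prefix j₁∈S j₁≢i x∈ (prefix-downward {s} x≺y (in-prefix y∈))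
    ... | no  j₁≢i | no  j₂≢i = rest.separated
      (x∈p∧x≢y⇒x∈p-y j₁∈S j₁≢i) (x∈p∧x≢y⇒x∈p-y j₂∈S j₂≢i) j₁≢j₂ x∈ z∈ y∈ (x≺y , y≺z)

  greedy : ∀ m (S : Subset k) (C : Fin k → Subset n) → PairwiseDisjoint C → ∣ S ∣ ≤ m →
    (∀ {j} → j ∈ S → m * a j ≤ d * ∣ C j ∣) → Selection S C
  greedy m S C disjoint ∣S∣≤m share with nonempty? S
  ... | no S-empty = empty-selection S-empty
  greedy zero    S C disjoint ∣S∣≤0 share | yes (j , j∈S) =
    contradiction (<-≤-trans (x∈p⇒∣p-x∣<∣p∣ j∈S) ∣S∣≤0) n≮0
  greedy (suc m) S C disjoint ∣S∣≤1+m share | yes (i₀ , i₀∈S) =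
    extend c (greedy m (S - i) (λ j → C j ─ prefix s) disjoint′ ∣S-i∣≤m share′)
    where
    c : Cut S C
    c = cut disjoint i₀∈S (≤-trans (m≤n*m (a i₀) (suc m)) (share i₀∈S))
    open Cut c

    disjoint′ : PairwiseDisjoint (λ j → C j ─ prefix s)
    disjoint′ = PairwiseDisjoint-⊆ (λ j → p─q⊆p (C j) (prefix s)) disjoint

    ∣S-i∣≤m : ∣ S - i ∣ ≤ m
    ∣S-i∣≤m = s≤s⁻¹ (<-≤-trans (x∈p⇒∣p-x∣<∣p∣ i∈S) ∣S∣≤1+m)

    share′ : ∀ {j} → j ∈ S - i → m * a j ≤ d * ∣ C j ─ prefix s ∣
    share′ {j} j∈S-i = ∣p─q∣-keeps-share m d (a j) (C j) (prefix s)
      (share (p─q⊆p S ⁅ i ⁆ j∈S-i)) (others-below-quota (p─q⊆p S ⁅ i ⁆ j∈S-i) (x∈p-y⇒x≢y S j∈S-i))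

lemma2p4 : (k n : ℕ) → 1 ≤ k → (A : Fin k → Subset n) → PairwiseDisjoint A → Covers A →
    (_≺_ : Fin n → Fin n → Set) → IsStrictTotalOrder _≡_ _≺_ →
    ∃ λ (B : Fin k → Subset n) →
      (∀ i → B i ⊆ A i)
      × (∀ i → ∣ A i ∣ ≤ k * ∣ B i ∣)
      × (∀ i j → i ≢ j → ∀ x y z → x ∈ B i → z ∈ B i → y ∈ B j → ¬ (x ≺ y × y ≺ z))
lemma2p4 k n _ A disjoint _ _≺_ ≺-sto =
    B
  , (λ i → B⊆C ∈⊤)
  , (λ i → quota ∈⊤)
  , (λ i j i≢j x y z → separated ∈⊤ ∈⊤ i≢j)
  where
  open Greedy ≺-sto k (λ i → ∣ A i ∣)
  open Selection (greedy k ⊤ A disjoint (≤-reflexive (∣⊤∣≡n k)) (λ _ → ≤-refl))
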